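{- Let $D$ be a strongly connected balanced bipartite digraph of order $2a$, where $a\geq 2$, such that $d(u)+d(v)\geq 3a+1$ for every dominating pair $\{u,v\}$ of vertices of $D$. If $D$ is not hamiltonian, then $d(u)\geq a+1$ for every vertex $u$ of $D$.
   Context: Digraphs have no loops and no multiple arcs. For a vertex $v$, $d(v)=d^+(v)+d^-(v)$ (out-degree plus in-degree). A pair of distinct vertices $\{u,v\}$ is dominating if there is a vertex $w$ with $uw$ and $vw$ both arcs of $D$. Balanced bipartite: two partite sets of equal size $a$. Hamiltonian: contains a directed cycle through all vertices. -}

module Defs where

open import Data.Nat using (ℕ; zero; suc; _+_; _*_; _≤_)
open import Data.Bool using (Bool; true; false; T; not; _xor_)
open import Data.Fin using (Fin)
open import Data.Fin.Permutation using (Permutation′; _⟨$⟩ʳ_)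
open import Data.List using (List; []; _∷_; filter; length)
open import Data.List.Relation.Unary.Linked using (Linked)
open import Data.Vec using (countᵇ; allFin)
open import Data.Product using (Σ; _×_; _,_; ∃)
open import Relation.Binary.PropositionalEquality using (_≡_)
open import Relation.Nullary using (¬_)
open import Relation.Nullary.Decidable using (T?)

-- A digraph on the vertex set Fin n: the arc relation is given by a
-- Boolean adjacency function (so at most one arc u→v: no multiple arcs).
record Digraph (n : ℕ) : Set where
  field
    arc      : Fin n → Fin n → Bool
    loopless : ∀ v → arc v v ≡ false

open Digraph public

Arc : ∀ {n} → Digraph n → Fin n → Fin n → Set
Arc D u v = T (arc D u v)

outdeg : ∀ {n} → Digraph n → Fin n → ℕ
outdeg {n} D v = countᵇ (λ w → arc D v w) (allFin n)

indeg : ∀ {n} → Digraph n → Fin n → ℕ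
indeg {n} D v = countᵇ (λ w → arc D w v) (allFin n)

deg : ∀ {n} → Digraph n → Fin n → ℕ
deg D v = outdeg D v + indeg D v

Dominating : ∀ {n} → Digraph n → Fin n → Fin n → Set
Dominating D u v = ¬ (u ≡ v) × ∃ λ w → Arc D u w × Arc D v w

data Path {n} (D : Digraph n) : Fin n → Fin n → Set where
  here : ∀ {u} → Path D u u
  step : ∀ {u w v} → Arc D u w → Path D w v → Path D u v

StronglyConnected : ∀ {n} → Digraph n → Set
StronglyConnected D = ∀ u v → Path D u v

BalancedBipartite : ∀ {n} → Digraph n → ℕ → Set
BalancedBipartite {n} D a =
  Σ (Fin n → Bool) λ side →
    (countᵇ side (allFin n) ≡ a) ×
    (countᵇ (λ v → not (side v)) (allFin n) ≡ a) ×
    (∀ u v → Arc D u v → ¬ (side u ≡ side v))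

open import Data.Fin using (zero; suc; fromℕ; inject₁)
Hamiltonian : ∀ {n} → Digraph n → Set
Hamiltonian {zero} D = ⊥′ where open import Data.Empty renaming (⊥ to ⊥′)
Hamiltonian {suc m} D =
  Σ (Permutation′ (suc m)) λ σ →
    (∀ (i : Fin m) → Arc D (σ ⟨$⟩ʳ inject₁ i) (σ ⟨$⟩ʳ suc i)) ×
    Arc D (σ ⟨$⟩ʳ fromℕ m) (σ ⟨$⟩ʳ zero)

module Submission where

-- Suppose some vertex u has d(u) ≤ a; we show that D is hamiltonian.
--
-- Call v exclusive if v is the only in-neighbour of each of its
-- out-neighbours.  The vertex u is exclusive, because a second in-neighbour
-- q of an out-neighbour of u would give d(u) + d(q) ≤ a + 2a.  If p is
-- exclusive and p → v, then v is exclusive: v has in-degree 1, so a rival q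
-- of v would need in-degree a, hence p → q, hence in-degree 1 < a.  By
-- strong connectivity every vertex is exclusive, i.e. every vertex has a
-- unique in-neighbour g(v).  Walking back along g from a fixed vertex then
-- visits every vertex (strong connectivity again) before it returns, and
-- this orbit, read backwards, is a hamiltonian cycle.

open import Defs
open import Data.Nat using (ℕ; zero; suc; _+_; _*_; _∸_; _≤_; _<_; z≤n; s≤s; _≤?_)
open import Data.Nat.Properties
  using (≤-reflexive; ≤-trans; <-cmp; +-comm; +-mono-≤; +-monoˡ-≤; +-monoʳ-<; +-cancelˡ-≤;
         +-cancelʳ-≤; +-∸-assoc; m∸n+n≡m; n∸n≡0; m≤n⇒m≤1+n; m≤n⇒m<n∨m≡n; <⇒≱; ≰⇒>; 1+n≰n;
         m+1+n≰m)
open import Data.Nat.GeneralisedArithmetic using (fold; fold-+)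
open import Data.Nat.Solver using (module +-*-Solver)
open import Data.Bool using (Bool; true; false; T; _xor_)
open import Data.Fin using (Fin; zero; suc; _≟_; toℕ; fromℕ; fromℕ<; inject₁; opposite)
open import Data.Fin.Properties
  using (toℕ-injective; toℕ-fromℕ; toℕ-fromℕ<; toℕ-inject; toℕ-inject₁; toℕ<n; toℕ≤pred[n];
         toℕ-cast; opposite-prop; ¬∀⟶∃¬-smallest; suc-injective)
open import Data.Fin.Permutation
  using (Permutation; Permutation′; permutation; _⟨$⟩ʳ_; _∘ₚ_; reverse; cast-id; ↔⇒≡)
open import Data.Vec using (Vec; []; _∷_; countᵇ; tabulate; allFin)
open import Data.Vec.Membership.Propositional using (_∈_)
open import Data.Vec.Membership.Propositional.Properties using (∈-allFin⁺)
open import Data.Vec.Relation.Unary.Any using (here; there)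
open import Data.Product using (_×_; _,_; ∃; proj₁; proj₂)
open import Data.Unit using (tt)
open import Data.Empty using (⊥-elim)
open import Data.Sum using (inj₁; inj₂)
open import Function using (_∘_)
open import Relation.Binary.PropositionalEquality
open import Relation.Binary using (tri<; tri≈; tri>)
open import Relation.Nullary using (¬_; yes; no; ¬?)
open import Relation.Nullary.Decidable using (decidable-stable; T?)
open import Relation.Unary using (Decidable)

module _ {A : Set} {p q : A → Bool} (p⇒q : ∀ x → T (p x) → T (q x)) where

  countᵇ-mono : ∀ {n} (xs : Vec A n) → countᵇ p xs ≤ countᵇ q xs
  countᵇ-mono []       = z≤n
  countᵇ-mono (x ∷ xs) with p x | q x | p⇒q x
  ... | true  | true  | _   = s≤s (countᵇ-mono xs)
  ... | true  | false | imp = ⊥-elim (imp tt)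
  ... | false | true  | _   = m≤n⇒m≤1+n (countᵇ-mono xs)
  ... | false | false | _   = countᵇ-mono xs

  countᵇ-mono-< : ∀ {n y} {xs : Vec A n} → y ∈ xs → T (q y) → ¬ T (p y) →
                  countᵇ p xs < countᵇ q xs
  countᵇ-mono-< {y = y} {_ ∷ xs} (here refl) qy ¬py with p y | q y
  ... | true  | _     = ⊥-elim (¬py tt)
  ... | false | true  = s≤s (countᵇ-mono xs)
  ... | false | false = ⊥-elim qy
  countᵇ-mono-< {xs = x ∷ xs} (there y∈xs) qy ¬py with p x | q x | p⇒q x
  ... | true  | true  | _   = s≤s (countᵇ-mono-< y∈xs qy ¬py)
  ... | true  | false | imp = ⊥-elim (imp tt)
  ... | false | true  | _   = m≤n⇒m≤1+n (countᵇ-mono-< y∈xs qy ¬py)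
  ... | false | false | _   = countᵇ-mono-< y∈xs qy ¬py

module _ {A : Set} where

  countᵇ-none : ∀ {n} (f : Fin n → A) (p : A → Bool) →
                (∀ i → ¬ T (p (f i))) → countᵇ p (tabulate f) ≡ 0
  countᵇ-none {zero}  f p none = refl
  countᵇ-none {suc n} f p none with p (f zero) | none zero
  ... | true  | ¬p0 = ⊥-elim (¬p0 tt)
  ... | false | _   = countᵇ-none (f ∘ suc) p (none ∘ suc)

  countᵇ-≤1 : ∀ {n} (f : Fin n → A) (p : A → Bool) →
              (∀ i j → T (p (f i)) → T (p (f j)) → i ≡ j) → countᵇ p (tabulate f) ≤ 1
  countᵇ-≤1 {zero}  f p once = z≤n
  countᵇ-≤1 {suc n} f p once with p (f zero) in p0
  ... | true  = s≤s (≤-reflexive (countᵇ-none (f ∘ suc) p none-later))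
    where
    none-later : ∀ i → ¬ T (p (f (suc i)))
    none-later i pi with once zero (suc i) (subst T (sym p0) tt) pi
    ... | ()
  ... | false = countᵇ-≤1 (f ∘ suc) p (λ i j pi pj → suc-injective (once (suc i) (suc j) pi pj))

least-witness : {P : ℕ → Set} → Decidable P → ∀ {k} → P k →
                ∃ λ p → P p × (∀ j → j < p → ¬ P j)
least-witness {P} P? {k} Pk
  with ¬∀⟶∃¬-smallest (suc k) (¬_ ∘ P ∘ toℕ) (¬? ∘ P? ∘ toℕ)
                       (λ ∀¬P → ∀¬P (fromℕ k) (subst P (sym (toℕ-fromℕ k)) Pk))
... | i , ¬¬Pi , below = toℕ i , decidable-stable (P? (toℕ i)) ¬¬Pi , none-below
  where
  none-below : ∀ j → j < toℕ i → ¬ P j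
  none-below j j<i = subst (¬_ ∘ P) (trans (toℕ-inject (fromℕ< j<i)) (toℕ-fromℕ< j<i))
                           (below (fromℕ< j<i))

last-arc : ∀ {n} {D : Digraph n} {s w t} → Arc D s w → Path D w t → ∃ λ q → Arc D q t
last-arc {s = s} s→w here = s , s→w
last-arc         _   (step w→w′ w′⇝t) = last-arc w→w′ w′⇝t

-- With at least two vertices, strong connectivity gives every vertex an
-- in-neighbour: reach it from a vertex other than itself.
in-neighbour : ∀ {n} {D : Digraph n} → StronglyConnected D →
               ∀ {v₀ v₁} → ¬ v₀ ≡ v₁ → ∀ v → ∃ λ q → Arc D q v
in-neighbour {D = D} sc {v₀} {v₁} v₀≢v₁ v with v ≟ v₀
... | yes refl = reached (sc v₁ v) (v₀≢v₁ ∘ sym)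
  where
  reached : ∀ {s t} → Path D s t → ¬ s ≡ t → ∃ λ q → Arc D q t
  reached here                s≢t = ⊥-elim (s≢t refl)
  reached (step s→w w⇝t) _   = last-arc s→w w⇝t
... | no v≢v₀  with sc v₀ v
...   | here           = ⊥-elim (v≢v₀ refl)
...   | step v₀→w w⇝v = last-arc v₀→w w⇝v

∸-toℕ : ∀ {m} (i : Fin m) → m ∸ toℕ i ≡ suc (m ∸ suc (toℕ i))
∸-toℕ {suc m} i = +-∸-assoc 1 (toℕ≤pred[n] i)

-- A strongly connected digraph in which every vertex has exactly one
-- in-neighbour g(v) is hamiltonian: the backward orbit x, g x, g² x, …
-- of a vertex x has least period equal to the number of vertices.

module UniqueInNeighbours {m : ℕ} (D : Digraph (suc m)) (sc : StronglyConnected D)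
  (in-nbr : ∀ v → ∃ λ q → Arc D q v)
  (in-nbr-unique : ∀ {q q′ v} → Arc D q v → Arc D q′ v → q ≡ q′) where

  g : Fin (suc m) → Fin (suc m)
  g v = proj₁ (in-nbr v)

  g-arc : ∀ v → Arc D (g v) v
  g-arc v = proj₂ (in-nbr v)

  -- Following a walk forwards is following g backwards.
  walk⇒fold : ∀ {v y} → Path D v y → ∃ λ k → v ≡ fold y g k
  walk⇒fold here = 0 , refl
  walk⇒fold (step v→w w⇝y) with walk⇒fold w⇝y
  ... | k , w≡ = suc k , trans (in-nbr-unique v→w (g-arc _)) (cong g w≡)

  x : Fin (suc m)
  x = zero

  orbit : ℕ → Fin (suc m)
  orbit k = fold x g k

  -- x lies on a cycle: the walk from x to g x comes back to x.
  returns : ∃ λ k → orbit (suc k) ≡ x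
  returns with walk⇒fold (sc x (g x))
  ... | k , x≡ = k , sym (begin
      x               ≡⟨ x≡ ⟩
      fold (g x) g k  ≡⟨ fold-+ x g k ⟨
      orbit (k + 1)   ≡⟨ cong orbit (+-comm k 1) ⟩
      orbit (suc k)   ∎)
    where open ≡-Reasoning

  least-return : ∃ λ p → orbit (suc p) ≡ x × (∀ j → j < p → ¬ orbit (suc j) ≡ x)
  least-return = least-witness {P = λ j → orbit (suc j) ≡ x} (λ j → orbit (suc j) ≟ x)
                               {proj₁ returns} (proj₂ returns)

  p₀ : ℕ
  p₀ = proj₁ least-return

  period : ℕ
  period = suc p₀

  orbit-period : orbit period ≡ x
  orbit-period = proj₁ (proj₂ least-return)

  orbit-mod : ∀ k → ∃ λ r → r < period × orbit k ≡ orbit r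
  orbit-mod zero = 0 , s≤s z≤n , refl
  orbit-mod (suc k) with orbit-mod k
  ... | r , r<p , eq with m≤n⇒m<n∨m≡n r<p
  ...   | inj₁ r+1<p = suc r , r+1<p , cong g eq
  ...   | inj₂ r+1≡p = 0 , s≤s z≤n , trans (cong g eq) (trans (cong orbit r+1≡p) orbit-period)

  -- If orbit i = orbit j with i < j < period, then walking period ∸ j
  -- further from orbit i returns to x before the least return time.
  no-early-repeat : ∀ {i j} → i < j → j < period → ¬ orbit i ≡ orbit j
  no-early-repeat {i} {j} i<j (s≤s j≤p₀) eq =
    proj₂ (proj₂ least-return) (e + i) e+i<p₀ returns-early
    where
    e : ℕ
    e = p₀ ∸ j
    e+j≡p₀ : e + j ≡ p₀
    e+j≡p₀ = m∸n+n≡m j≤p₀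
    e+i<p₀ : e + i < p₀
    e+i<p₀ = subst (e + i <_) e+j≡p₀ (+-monoʳ-< e i<j)
    returns-early : orbit (suc (e + i)) ≡ x
    returns-early = begin
      orbit (suc e + i)          ≡⟨ fold-+ x g (suc e) ⟩
      fold (orbit i) g (suc e)   ≡⟨ cong (λ z → fold z g (suc e)) eq ⟩
      fold (orbit j) g (suc e)   ≡⟨ fold-+ x g (suc e) ⟨
      orbit (suc e + j)          ≡⟨ cong (orbit ∘ suc) e+j≡p₀ ⟩
      orbit period               ≡⟨ orbit-period ⟩
      x                          ∎
      where open ≡-Reasoning

  orbit-injective : ∀ {i j} → i < period → j < period → orbit i ≡ orbit j → i ≡ j
  orbit-injective {i} {j} i<p j<p eq with <-cmp i j
  ... | tri< i<j _ _ = ⊥-elim (no-early-repeat i<j j<p eq)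
  ... | tri≈ _ i≡j _ = i≡j
  ... | tri> _ _ j<i = ⊥-elim (no-early-repeat j<i i<p (sym eq))

  -- Every vertex lies on the orbit, reached by its walk to x.
  on-orbit : ∀ v → ∃ λ r → r < period × v ≡ orbit r
  on-orbit v with walk⇒fold (sc v x)
  ... | k , v≡ with orbit-mod k
  ...   | r , r<p , eq = r , r<p , trans v≡ eq

  orbit-bijection : Permutation period (suc m)
  orbit-bijection = permutation (orbit ∘ toℕ) position reached recovered
    where
    position : Fin (suc m) → Fin period
    position v = fromℕ< (proj₁ (proj₂ (on-orbit v)))
    reached : ∀ v → orbit (toℕ (position v)) ≡ v
    reached v = trans (cong orbit (toℕ-fromℕ< (proj₁ (proj₂ (on-orbit v)))))
                      (sym (proj₂ (proj₂ (on-orbit v))))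
    recovered : ∀ i → position (orbit (toℕ i)) ≡ i
    recovered i = toℕ-injective (trans (toℕ-fromℕ< r<p) (orbit-injective r<p (toℕ<n i) (sym eq)))
      where
      r : ℕ
      r = proj₁ (on-orbit (orbit (toℕ i)))
      r<p : r < period
      r<p = proj₁ (proj₂ (on-orbit (orbit (toℕ i))))
      eq : orbit (toℕ i) ≡ orbit r
      eq = proj₂ (proj₂ (on-orbit (orbit (toℕ i))))

  period≡ : period ≡ suc m
  period≡ = ↔⇒≡ orbit-bijection

  -- The hamiltonian cycle: the orbit read backwards.
  cycle : Permutation′ (suc m)
  cycle = reverse ∘ₚ cast-id (sym period≡) ∘ₚ orbit-bijection

  cycle-at : ∀ i → cycle ⟨$⟩ʳ i ≡ orbit (m ∸ toℕ i)
  cycle-at i = cong orbit (trans (toℕ-cast (sym period≡) (opposite i)) (opposite-prop i))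

  cycle-arc : ∀ (i : Fin m) → Arc D (cycle ⟨$⟩ʳ inject₁ i) (cycle ⟨$⟩ʳ suc i)
  cycle-arc i = subst₂ (Arc D) (sym (trans (cycle-at (inject₁ i)) steps)) (sym (cycle-at (suc i)))
                       (g-arc (orbit (m ∸ suc (toℕ i))))
    where
    steps : orbit (m ∸ toℕ (inject₁ i)) ≡ orbit (suc (m ∸ suc (toℕ i)))
    steps = cong orbit (trans (cong (m ∸_) (toℕ-inject₁ i)) (∸-toℕ i))

  closing-arc : Arc D (cycle ⟨$⟩ʳ fromℕ m) (cycle ⟨$⟩ʳ zero)
  closing-arc = subst₂ (Arc D) (sym (trans (cycle-at (fromℕ m)) starts-at-x)) (sym (cycle-at zero))
                       (subst (λ v → Arc D v (orbit m)) returns-to-x (g-arc (orbit m)))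
    where
    starts-at-x : orbit (m ∸ toℕ (fromℕ m)) ≡ x
    starts-at-x = cong orbit (trans (cong (m ∸_) (toℕ-fromℕ m)) (n∸n≡0 m))
    returns-to-x : orbit (suc m) ≡ x
    returns-to-x = trans (cong orbit (sym period≡)) orbit-period

  hamiltonian : Hamiltonian D
  hamiltonian = cycle , cycle-arc , closing-arc

module Bipartite {n a : ℕ} (D : Digraph n) (bb : BalancedBipartite D a) where

  side : Fin n → Bool
  side = proj₁ bb

  across : Fin n → Fin n → Bool
  across v w = side v xor side w

  ≢⇒xor : ∀ {b c} → ¬ b ≡ c → T (b xor c)
  ≢⇒xor {false} {false} b≢c = b≢c refl
  ≢⇒xor {false} {true}  _   = tt
  ≢⇒xor {true}  {false} _   = tt
  ≢⇒xor {true}  {true}  b≢c = b≢c refl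

  count-across : ∀ v → countᵇ (across v) (allFin n) ≡ a
  count-across v with side v
  ... | true  = proj₁ (proj₂ (proj₂ bb))
  ... | false = proj₁ (proj₂ bb)

  arc-across : ∀ {v w} → Arc D v w → T (across v w)
  arc-across {v} {w} v→w = ≢⇒xor (proj₂ (proj₂ (proj₂ bb)) v w v→w)

  arc-across′ : ∀ {v w} → Arc D w v → T (across v w)
  arc-across′ {v} {w} w→v = ≢⇒xor (proj₂ (proj₂ (proj₂ bb)) w v w→v ∘ sym)

  across-odd : ∀ {u v w z} → T (across u v) → T (across v w) → T (across w z) → T (across u z)
  across-odd {u} {v} {w} {z} = xor-odd {side u} {side v} {side w} {side z}
    where
    xor-odd : ∀ {b c d e} → T (b xor c) → T (c xor d) → T (d xor e) → T (b xor e)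
    xor-odd {true}  {true}  ()
    xor-odd {false} {false} ()
    xor-odd {true}  {false} {false} _ ()
    xor-odd {false} {true}  {true}  _ ()
    xor-odd {true}  {false} {true}  {true}  _ _ ()
    xor-odd {false} {true}  {false} {false} _ _ ()
    xor-odd {true}  {false} {true}  {false} _ _ _ = tt
    xor-odd {false} {true}  {false} {true}  _ _ _ = tt

  -- All out- and in-neighbours of v lie across from v.
  outdeg≤ : ∀ v → outdeg D v ≤ a
  outdeg≤ v = subst (outdeg D v ≤_) (count-across v) (countᵇ-mono (λ _ → arc-across) (allFin n))

  indeg≤ : ∀ v → indeg D v ≤ a
  indeg≤ v = subst (indeg D v ≤_) (count-across v) (countᵇ-mono (λ _ → arc-across′) (allFin n))

  deg≤ : ∀ v → deg D v ≤ a + a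
  deg≤ v = +-mono-≤ (outdeg≤ v) (indeg≤ v)

  full-indeg : ∀ {w p} → a ≤ indeg D w → T (across w p) → Arc D p w
  full-indeg {w} {p} a≤indeg p-across = decidable-stable (T? (arc D p w)) λ ¬p→w →
    <⇒≱ (subst (indeg D w <_) (count-across w)
           (countᵇ-mono-< (λ _ → arc-across′) (∈-allFin⁺ p) p-across ¬p→w))
        a≤indeg

Exclusive : ∀ {n} → Digraph n → Fin n → Set
Exclusive D v = ∀ {w q} → Arc D v w → Arc D q w → q ≡ v

exclusive⇒indeg≤1 : ∀ {n} (D : Digraph n) {p v} → Exclusive D p → Arc D p v → indeg D v ≤ 1
exclusive⇒indeg≤1 D {v = v} excl p→v =
  countᵇ-≤1 (λ w → w) (λ w → arc D w v)
            (λ i j i→v j→v → trans (excl p→v i→v) (sym (excl p→v j→v)))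

3a+1≡ : ∀ a → 3 * a + 1 ≡ (a + 1) + (a + a)
3a+1≡ = solve 1 (λ a → con 3 :* a :+ con 1 := (a :+ con 1) :+ (a :+ a)) refl
  where open +-*-Solver

3a+1≰a+2a : ∀ a → ¬ 3 * a + 1 ≤ a + (a + a)
3a+1≰a+2a a le =
  m+1+n≰m a (+-cancelʳ-≤ (a + a) (a + 1) a (subst (_≤ a + (a + a)) (3a+1≡ a) le))

3a+1≤⇒a≤ : ∀ a x → 3 * a + 1 ≤ (a + 1) + (a + x) → a ≤ x
3a+1≤⇒a≤ a x le = +-cancelˡ-≤ a a x (+-cancelˡ-≤ (a + 1) (a + a) (a + x)
                     (subst (_≤ (a + 1) + (a + x)) (3a+1≡ a) le))

module Propagation {n a : ℕ} (D : Digraph n) (sc : StronglyConnected D)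
  (bb : BalancedBipartite D a)
  (dom : ∀ u v → Dominating D u v → 3 * a + 1 ≤ deg D u + deg D v)
  (a≥2 : 2 ≤ a) where

  open Bipartite D bb

  -- A vertex of degree at most a is exclusive: a rival q would form with
  -- it a dominating pair of degree sum at most a + 2a.
  low-degree-exclusive : ∀ {u} → deg D u ≤ a → Exclusive D u
  low-degree-exclusive {u} deg≤a {w} {q} u→w q→w with q ≟ u
  ... | yes q≡u = q≡u
  ... | no  q≢u = ⊥-elim (3a+1≰a+2a a
        (≤-trans (dom u q (q≢u ∘ sym , w , u→w , q→w)) (+-mono-≤ deg≤a (deg≤ q))))

  -- Exclusiveness passes along arcs.  If p → v with p exclusive, v has
  -- in-degree 1; a rival q of v then needs in-degree a, so p → q, so q
  -- also has in-degree 1 < 2 ≤ a.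
  exclusive-step : ∀ {p v} → Exclusive D p → Arc D p v → Exclusive D v
  exclusive-step {p} {v} excl p→v {w} {q} v→w q→w with q ≟ v
  ... | yes q≡v = q≡v
  ... | no  q≢v = ⊥-elim (1+n≰n (≤-trans a≥2 (≤-trans a≤indeg-q (exclusive⇒indeg≤1 D excl p→q))))
    where
    deg-sum≤ : deg D v + deg D q ≤ (a + 1) + (a + indeg D q)
    deg-sum≤ = +-mono-≤ (+-mono-≤ (outdeg≤ v) (exclusive⇒indeg≤1 D excl p→v))
                        (+-monoˡ-≤ (indeg D q) (outdeg≤ q))
    a≤indeg-q : a ≤ indeg D q
    a≤indeg-q = 3a+1≤⇒a≤ a (indeg D q) (≤-trans (dom v q (q≢v ∘ sym , w , v→w , q→w)) deg-sum≤)
    p→q : Arc D p q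
    p→q = full-indeg a≤indeg-q (across-odd (arc-across q→w) (arc-across′ v→w) (arc-across′ p→v))

  exclusive-along : ∀ {s t} → Path D s t → Exclusive D s → Exclusive D t
  exclusive-along here           excl = excl
  exclusive-along (step s→w w⇝t) excl = exclusive-along w⇝t (exclusive-step excl s→w)

  -- Since every vertex is reached from u, in-neighbours are unique.
  unique-in-neighbours : ∀ {u} → deg D u ≤ a → ∀ {q q′ v} → Arc D q v → Arc D q′ v → q ≡ q′
  unique-in-neighbours {u} deg≤a {q} q→v q′→v =
    sym (exclusive-along (sc u q) (low-degree-exclusive deg≤a) q→v q′→v)

low-degree⇒hamiltonian : ∀ {m a} (D : Digraph (suc (suc m))) → StronglyConnected D →
  BalancedBipartite D a → 2 ≤ a →
  (∀ u v → Dominating D u v → 3 * a + 1 ≤ deg D u + deg D v) →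
  ∀ {u} → deg D u ≤ a → Hamiltonian D
low-degree⇒hamiltonian D sc bb a≥2 dom deg≤a =
  UniqueInNeighbours.hamiltonian D sc (in-neighbour sc {zero} {suc zero} (λ ()))
    (Propagation.unique-in-neighbours D sc bb dom a≥2 deg≤a)

lemma3p2 : (a : ℕ) → 2 ≤ a → (D : Digraph (a + a)) →
    StronglyConnected D → BalancedBipartite D a →
    (∀ u v → Dominating D u v → 3 * a + 1 ≤ deg D u + deg D v) →
    ¬ Hamiltonian D →
    ∀ u → a + 1 ≤ deg D u
lemma3p2 zero          ()
lemma3p2 (suc zero)    (s≤s ())
lemma3p2 a@(suc (suc _)) a≥2 D sc bb dom ¬ham u with deg D u ≤? a
... | yes deg≤a = ⊥-elim (¬ham (low-degree⇒hamiltonian D sc bb a≥2 dom deg≤a))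
... | no  deg≰a = subst (_≤ deg D u) (+-comm 1 a) (≰⇒> deg≰a)
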